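{- Let $G_1$ and $G_2$ be two connected graphs. Then $$\max\{D(G_1),D(G_2)\}\leq D(G_1+G_2)\leq D(G_1)+D(G_2).$$
   Context: All graphs are finite and simple. For graphs $G_1=(V_1,E_1)$ and $G_2=(V_2,E_2)$ on disjoint vertex sets, the join $G_1+G_2$ is the graph with vertex set $V_1\cup V_2$ and edge set $E_1\cup E_2\cup\{uv: u\in V_1, v\in V_2\}$. A labeling $\phi:V(G)\to\{1,\ldots,r\}$ is $r$-distinguishing if the only automorphism $\sigma$ of $G$ with $\phi(\sigma(x))=\phi(x)$ for all $x\in V(G)$ is the identity. The distinguishing number $D(G)$ is the least $r$ such that $G$ has an $r$-distinguishing labeling. -}

module Defs where

open import Data.Nat using (ℕ; zero; suc; _+_; _≤_; _⊔_)
open import Data.Fin using (Fin; splitAt)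
open import Data.Fin.Permutation using (Permutation′; _⟨$⟩ʳ_)
open import Data.Bool using (Bool; true; false)
open import Data.Sum using (_⊎_; inj₁; inj₂)
open import Data.Product using (Σ; _×_; _,_)
open import Relation.Binary.PropositionalEquality using (_≡_)

record Graph : Set where
  constructor mkGraph
  field
    n   : ℕ
    adj : Fin n → Fin n → Bool
open Graph public

record Simple (G : Graph) : Set where
  field
    adj-sym    : ∀ x y → adj G x y ≡ adj G y x
    adj-irrefl : ∀ x → adj G x x ≡ false

data Reach (G : Graph) : Fin (n G) → Fin (n G) → Set where
  here : ∀ {u} → Reach G u u
  step : ∀ {u w v} → adj G u w ≡ true → Reach G w v → Reach G u v

record Connected (G : Graph) : Set where
  field
    nonempty  : 1 ≤ n G
    reachable : ∀ u v → Reach G u v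

-- Join G₁ + G₂ on vertex set Fin (n₁ + n₂): first n₁ vertices are G₁, rest G₂.
joinAdj : (G₁ G₂ : Graph) → Fin (n G₁) ⊎ Fin (n G₂) → Fin (n G₁) ⊎ Fin (n G₂) → Bool
joinAdj G₁ G₂ (inj₁ a) (inj₁ b) = adj G₁ a b
joinAdj G₁ G₂ (inj₂ a) (inj₂ b) = adj G₂ a b
joinAdj G₁ G₂ (inj₁ a) (inj₂ b) = true
joinAdj G₁ G₂ (inj₂ a) (inj₁ b) = true

_⊕_ : Graph → Graph → Graph
G₁ ⊕ G₂ = mkGraph (n G₁ + n G₂)
  (λ x y → joinAdj G₁ G₂ (splitAt (n G₁) x) (splitAt (n G₁) y))

IsAutomorphism : (G : Graph) → Permutation′ (n G) → Set
IsAutomorphism G σ = ∀ x y → adj G (σ ⟨$⟩ʳ x) (σ ⟨$⟩ʳ y) ≡ adj G x y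

IsDistinguishing : (G : Graph) (r : ℕ) → (Fin (n G) → Fin r) → Set
IsDistinguishing G r φ =
  ∀ (σ : Permutation′ (n G)) → IsAutomorphism G σ →
  (∀ x → φ (σ ⟨$⟩ʳ x) ≡ φ x) → ∀ x → σ ⟨$⟩ʳ x ≡ x

HasDistinguishing : Graph → ℕ → Set
HasDistinguishing G r = Σ (Fin (n G) → Fin r) (IsDistinguishing G r)

IsDistinguishingNumber : Graph → ℕ → Set
IsDistinguishingNumber G d =
  HasDistinguishing G d × (∀ r → HasDistinguishing G r → d ≤ r)

-- Lower bound: restricting a distinguishing labeling of G₁ + G₂ to one side distinguishes that
-- side, since every automorphism of G₁ extends (by the identity on G₂) to an automorphism of the join.
-- Upper bound: label G₁ with colours 1..d₁ and G₂ with colours d₁+1..d₁+d₂ by distinguishing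
-- labelings. A colour-preserving automorphism of the join then maps each side onto itself, so it
-- restricts to colour-preserving automorphisms of G₁ and G₂, which are the identity.

module Submission where

open import Defs
open import Data.Nat using (ℕ; _≤_; _+_; _⊔_)
open import Data.Nat.Properties using (⊔-lub)
open import Data.Bool using (Bool; true; false)
open import Data.Fin using (Fin; splitAt; join; _↑ˡ_; _↑ʳ_)
open import Data.Fin.Properties
  using (+↔⊎; splitAt-↑ˡ; splitAt-↑ʳ; splitAt⁻¹-↑ˡ; splitAt⁻¹-↑ʳ; splitAt-join; join-splitAt; ↑ˡ-injective; ↑ʳ-injective)
open import Data.Fin.Permutation using (Permutation′; _⟨$⟩ʳ_)
import Data.Fin.Permutation as Permutation
open import Data.Product using (_×_; _,_)
open import Data.Sum using (_⊎_; inj₁; inj₂; [_,_]′)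
import Data.Sum as Sum
open import Data.Sum.Properties using (inj₁-injective; inj₂-injective; map-id; map-cong)
open import Data.Sum.Function.Propositional using (_⊎-↔_)
open import Function using (_∘_; id; const)
open import Function.Bundles using (_↔_; Inverse; mk↔ₛ′)
open import Function.Construct.Composition using (_↔-∘_)
open import Function.Construct.Symmetry using (↔-sym)
open import Relation.Binary.PropositionalEquality
open ≡-Reasoning

isInj₁ : ∀ {A B : Set} → A ⊎ B → Bool
isInj₁ = [ const true , const false ]′

isInj₁-map : ∀ {A B C D : Set} (f : A → C) (g : B → D) u → isInj₁ (Sum.map f g u) ≡ isInj₁ u
isInj₁-map f g (inj₁ _) = refl
isInj₁-map f g (inj₂ _) = refl

module _ {A B : Set} where

  SidePreserving : (A ⊎ B → A ⊎ B) → Set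
  SidePreserving s = ∀ u → isInj₁ (s u) ≡ isInj₁ u

  -- The fallback values are never reached on side-preserving maps.
  restrictˡ : (A ⊎ B → A ⊎ B) → A → A
  restrictˡ s a = [ id , const a ]′ (s (inj₁ a))

  restrictʳ : (A ⊎ B → A ⊎ B) → B → B
  restrictʳ s b = [ const b , id ]′ (s (inj₂ b))

  module _ (s : A ⊎ B → A ⊎ B) (sp : SidePreserving s) where

    inj₁-restrictˡ : ∀ a → s (inj₁ a) ≡ inj₁ (restrictˡ s a)
    inj₁-restrictˡ a with s (inj₁ a) | sp (inj₁ a)
    ... | inj₁ _ | _ = refl
    ... | inj₂ _ | ()

    inj₂-restrictʳ : ∀ b → s (inj₂ b) ≡ inj₂ (restrictʳ s b)
    inj₂-restrictʳ b with s (inj₂ b) | sp (inj₂ b)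
    ... | inj₂ _ | _ = refl
    ... | inj₁ _ | ()

    sidePreserving-≗-map : ∀ u → s u ≡ Sum.map (restrictˡ s) (restrictʳ s) u
    sidePreserving-≗-map (inj₁ a) = inj₁-restrictˡ a
    sidePreserving-≗-map (inj₂ b) = inj₂-restrictʳ b

  module _ {C D : Set} (f : A → C) (g : B → D) (s : A ⊎ B → A ⊎ B)
           (pres : ∀ u → Sum.map f g (s u) ≡ Sum.map f g u) where

    map-preserved⇒sidePreserving : SidePreserving s
    map-preserved⇒sidePreserving u = begin
      isInj₁ (s u)                 ≡⟨ isInj₁-map f g (s u) ⟨
      isInj₁ (Sum.map f g (s u))   ≡⟨ cong isInj₁ (pres u) ⟩
      isInj₁ (Sum.map f g u)       ≡⟨ isInj₁-map f g u ⟩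
      isInj₁ u                     ∎

    restrictˡ-preserves : ∀ a → f (restrictˡ s a) ≡ f a
    restrictˡ-preserves a = inj₁-injective
      (trans (cong (Sum.map f g) (sym (inj₁-restrictˡ s map-preserved⇒sidePreserving a))) (pres (inj₁ a)))

    restrictʳ-preserves : ∀ b → g (restrictʳ s b) ≡ g b
    restrictʳ-preserves b = inj₂-injective
      (trans (cong (Sum.map f g) (sym (inj₂-restrictʳ s map-preserved⇒sidePreserving b))) (pres (inj₂ b)))

  module _ (s t : A ⊎ B → A ⊎ B) (sp : SidePreserving s) (tp : SidePreserving t)
           (s∘t≗id : ∀ u → s (t u) ≡ u) where

    restrictˡ-inverse : ∀ a → restrictˡ s (restrictˡ t a) ≡ a
    restrictˡ-inverse a = inj₁-injective (begin
      inj₁ (restrictˡ s (restrictˡ t a)) ≡⟨ inj₁-restrictˡ s sp _ ⟨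
      s (inj₁ (restrictˡ t a))           ≡⟨ cong s (inj₁-restrictˡ t tp a) ⟨
      s (t (inj₁ a))                     ≡⟨ s∘t≗id (inj₁ a) ⟩
      inj₁ a                             ∎)

    restrictʳ-inverse : ∀ b → restrictʳ s (restrictʳ t b) ≡ b
    restrictʳ-inverse b = inj₂-injective (begin
      inj₂ (restrictʳ s (restrictʳ t b)) ≡⟨ inj₂-restrictʳ s sp _ ⟨
      s (inj₂ (restrictʳ t b))           ≡⟨ cong s (inj₂-restrictʳ t tp b) ⟨
      s (t (inj₂ b))                     ≡⟨ s∘t≗id (inj₂ b) ⟩
      inj₂ b                             ∎)

  module _ (π : (A ⊎ B) ↔ (A ⊎ B)) (sp : SidePreserving (Inverse.to π)) where
    open Inverse π

    from-sidePreserving : SidePreserving from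
    from-sidePreserving u = trans (sym (sp (from u))) (cong isInj₁ (strictlyInverseˡ u))

    restrictˡ-↔ : A ↔ A
    restrictˡ-↔ = mk↔ₛ′ (restrictˡ to) (restrictˡ from)
      (restrictˡ-inverse to from sp from-sidePreserving strictlyInverseˡ)
      (restrictˡ-inverse from to from-sidePreserving sp strictlyInverseʳ)

    restrictʳ-↔ : B ↔ B
    restrictʳ-↔ = mk↔ₛ′ (restrictʳ to) (restrictʳ from)
      (restrictʳ-inverse to from sp from-sidePreserving strictlyInverseˡ)
      (restrictʳ-inverse from to from-sidePreserving sp strictlyInverseʳ)

module _ {m k : ℕ} where

  toSum : Permutation′ (m + k) → (Fin m ⊎ Fin k) ↔ (Fin m ⊎ Fin k)
  toSum σ = +↔⊎ ↔-∘ (σ ↔-∘ ↔-sym +↔⊎)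

  fromSum : (Fin m ⊎ Fin k) ↔ (Fin m ⊎ Fin k) → Permutation′ (m + k)
  fromSum π = ↔-sym +↔⊎ ↔-∘ (π ↔-∘ +↔⊎)

  toSum-≗id : ∀ σ → (∀ u → Inverse.to (toSum σ) u ≡ u) → ∀ x → σ ⟨$⟩ʳ x ≡ x
  toSum-≗id σ s≗id x = begin
    σ ⟨$⟩ʳ x                                       ≡⟨ join-splitAt m k _ ⟨
    join m k (splitAt m (σ ⟨$⟩ʳ x))                ≡⟨ cong (λ y → join m k (splitAt m (σ ⟨$⟩ʳ y))) (join-splitAt m k x) ⟨
    join m k (Inverse.to (toSum σ) (splitAt m x))  ≡⟨ cong (join m k) (s≗id (splitAt m x)) ⟩
    join m k (splitAt m x)                         ≡⟨ join-splitAt m k x ⟩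
    x                                              ∎

  _⊕ₚ_ : Permutation′ m → Permutation′ k → Permutation′ (m + k)
  τ₁ ⊕ₚ τ₂ = fromSum (τ₁ ⊎-↔ τ₂)

  ⊕ₚ-↑ˡ : ∀ τ₁ τ₂ a → (τ₁ ⊕ₚ τ₂) ⟨$⟩ʳ (a ↑ˡ k) ≡ (τ₁ ⟨$⟩ʳ a) ↑ˡ k
  ⊕ₚ-↑ˡ τ₁ τ₂ a rewrite splitAt-↑ˡ m a k = refl

  ⊕ₚ-↑ʳ : ∀ τ₁ τ₂ b → (τ₁ ⊕ₚ τ₂) ⟨$⟩ʳ (m ↑ʳ b) ≡ m ↑ʳ (τ₂ ⟨$⟩ʳ b)
  ⊕ₚ-↑ʳ τ₁ τ₂ b rewrite splitAt-↑ʳ m k b = refl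

  ⊕ₚ-preserves : ∀ {r} (φ : Fin (m + k) → Fin r) τ₁ τ₂ →
    (∀ a → φ ((τ₁ ⟨$⟩ʳ a) ↑ˡ k) ≡ φ (a ↑ˡ k)) →
    (∀ b → φ (m ↑ʳ (τ₂ ⟨$⟩ʳ b)) ≡ φ (m ↑ʳ b)) →
    ∀ x → φ ((τ₁ ⊕ₚ τ₂) ⟨$⟩ʳ x) ≡ φ x
  ⊕ₚ-preserves φ τ₁ τ₂ pres₁ pres₂ x with splitAt m x in eq
  ... | inj₁ a = trans (pres₁ a) (cong φ (splitAt⁻¹-↑ˡ eq))
  ... | inj₂ b = trans (pres₂ b) (cong φ (splitAt⁻¹-↑ʳ eq))

module _ (G₁ G₂ : Graph) where

  private
    m k : ℕ
    m = n G₁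
    k = n G₂

  IsSumAutomorphism : (Fin m ⊎ Fin k → Fin m ⊎ Fin k) → Set
  IsSumAutomorphism s = ∀ u v → joinAdj G₁ G₂ (s u) (s v) ≡ joinAdj G₁ G₂ u v

  map-isSumAutomorphism : ∀ {τ₁ τ₂} → IsAutomorphism G₁ τ₁ → IsAutomorphism G₂ τ₂ →
    IsSumAutomorphism (Sum.map (τ₁ ⟨$⟩ʳ_) (τ₂ ⟨$⟩ʳ_))
  map-isSumAutomorphism aut₁ aut₂ (inj₁ a) (inj₁ b) = aut₁ a b
  map-isSumAutomorphism aut₁ aut₂ (inj₁ a) (inj₂ b) = refl
  map-isSumAutomorphism aut₁ aut₂ (inj₂ a) (inj₁ b) = refl
  map-isSumAutomorphism aut₁ aut₂ (inj₂ a) (inj₂ b) = aut₂ a b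

  fromSum-isAutomorphism : ∀ π → IsSumAutomorphism (Inverse.to π) → IsAutomorphism (G₁ ⊕ G₂) (fromSum π)
  fromSum-isAutomorphism π aut x y =
    trans (cong₂ (joinAdj G₁ G₂) (splitAt-join m k (to (splitAt m x))) (splitAt-join m k (to (splitAt m y))))
          (aut (splitAt m x) (splitAt m y))
    where open Inverse π

  toSum-isSumAutomorphism : ∀ σ → IsAutomorphism (G₁ ⊕ G₂) σ → IsSumAutomorphism (Inverse.to (toSum σ))
  toSum-isSumAutomorphism σ aut u v =
    trans (aut (join m k u) (join m k v)) (cong₂ (joinAdj G₁ G₂) (splitAt-join m k u) (splitAt-join m k v))

  ⊕ₚ-isAutomorphism : ∀ τ₁ τ₂ → IsAutomorphism G₁ τ₁ → IsAutomorphism G₂ τ₂ →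
    IsAutomorphism (G₁ ⊕ G₂) (τ₁ ⊕ₚ τ₂)
  ⊕ₚ-isAutomorphism τ₁ τ₂ aut₁ aut₂ =
    fromSum-isAutomorphism (τ₁ ⊎-↔ τ₂) (map-isSumAutomorphism {τ₁} {τ₂} aut₁ aut₂)

  module _ (π : (Fin m ⊎ Fin k) ↔ (Fin m ⊎ Fin k)) (sp : SidePreserving (Inverse.to π))
           (aut : IsSumAutomorphism (Inverse.to π)) where
    open Inverse π using (to)

    restrictˡ-isAutomorphism : IsAutomorphism G₁ (restrictˡ-↔ π sp)
    restrictˡ-isAutomorphism a b = begin
      adj G₁ (restrictˡ to a) (restrictˡ to b)  ≡⟨ cong₂ (joinAdj G₁ G₂) (inj₁-restrictˡ to sp a) (inj₁-restrictˡ to sp b) ⟨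
      joinAdj G₁ G₂ (to (inj₁ a)) (to (inj₁ b)) ≡⟨ aut (inj₁ a) (inj₁ b) ⟩
      adj G₁ a b                                ∎

    restrictʳ-isAutomorphism : IsAutomorphism G₂ (restrictʳ-↔ π sp)
    restrictʳ-isAutomorphism a b = begin
      adj G₂ (restrictʳ to a) (restrictʳ to b)  ≡⟨ cong₂ (joinAdj G₁ G₂) (inj₂-restrictʳ to sp a) (inj₂-restrictʳ to sp b) ⟨
      joinAdj G₁ G₂ (to (inj₂ a)) (to (inj₂ b)) ≡⟨ aut (inj₂ a) (inj₂ b) ⟩
      adj G₂ a b                                ∎

module _ {G₁ G₂ : Graph} {r : ℕ} where

  private
    m k : ℕ
    m = n G₁
    k = n G₂

  ↑ˡ-distinguishing : ∀ {φ} → IsDistinguishing (G₁ ⊕ G₂) r φ → IsDistinguishing G₁ r (φ ∘ (_↑ˡ k))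
  ↑ˡ-distinguishing {φ} dist τ aut pres a = ↑ˡ-injective k _ _ (begin
    (τ ⟨$⟩ʳ a) ↑ˡ k     ≡⟨ ⊕ₚ-↑ˡ τ Permutation.id a ⟨
    σ ⟨$⟩ʳ (a ↑ˡ k)     ≡⟨ dist σ (⊕ₚ-isAutomorphism G₁ G₂ τ Permutation.id aut (λ _ _ → refl))
                                   (⊕ₚ-preserves φ τ Permutation.id pres (λ _ → refl)) (a ↑ˡ k) ⟩
    a ↑ˡ k              ∎)
    where
    σ : Permutation′ (m + k)
    σ = τ ⊕ₚ Permutation.id

  ↑ʳ-distinguishing : ∀ {φ} → IsDistinguishing (G₁ ⊕ G₂) r φ → IsDistinguishing G₂ r (φ ∘ (m ↑ʳ_))
  ↑ʳ-distinguishing {φ} dist τ aut pres b = ↑ʳ-injective m _ _ (begin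
    m ↑ʳ (τ ⟨$⟩ʳ b)     ≡⟨ ⊕ₚ-↑ʳ Permutation.id τ b ⟨
    σ ⟨$⟩ʳ (m ↑ʳ b)     ≡⟨ dist σ (⊕ₚ-isAutomorphism G₁ G₂ Permutation.id τ (λ _ _ → refl) aut)
                                   (⊕ₚ-preserves φ Permutation.id τ (λ _ → refl) pres) (m ↑ʳ b) ⟩
    m ↑ʳ b              ∎)
    where
    σ : Permutation′ (m + k)
    σ = Permutation.id ⊕ₚ τ

joinLabeling : ∀ {m k d₁ d₂} → (Fin m → Fin d₁) → (Fin k → Fin d₂) → Fin (m + k) → Fin (d₁ + d₂)
joinLabeling {m} {k} {d₁} {d₂} φ₁ φ₂ = join d₁ d₂ ∘ Sum.map φ₁ φ₂ ∘ splitAt m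

module _ {m k d₁ d₂ : ℕ} (φ₁ : Fin m → Fin d₁) (φ₂ : Fin k → Fin d₂) (σ : Permutation′ (m + k)) where

  joinLabeling-preserved : (∀ x → joinLabeling φ₁ φ₂ (σ ⟨$⟩ʳ x) ≡ joinLabeling φ₁ φ₂ x) →
    ∀ u → Sum.map φ₁ φ₂ (Inverse.to (toSum σ) u) ≡ Sum.map φ₁ φ₂ u
  joinLabeling-preserved pres u = begin
    Sum.map φ₁ φ₂ (Inverse.to (toSum σ) u)                  ≡⟨ splitAt-join d₁ d₂ _ ⟨
    splitAt d₁ (joinLabeling φ₁ φ₂ (σ ⟨$⟩ʳ join m k u))    ≡⟨ cong (splitAt d₁) (pres (join m k u)) ⟩
    splitAt d₁ (joinLabeling φ₁ φ₂ (join m k u))            ≡⟨ splitAt-join d₁ d₂ _ ⟩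
    Sum.map φ₁ φ₂ (splitAt m (join m k u))                  ≡⟨ cong (Sum.map φ₁ φ₂) (splitAt-join m k u) ⟩
    Sum.map φ₁ φ₂ u                                         ∎

joinLabeling-distinguishing : ∀ {G₁ G₂ d₁ d₂ φ₁ φ₂} →
  IsDistinguishing G₁ d₁ φ₁ → IsDistinguishing G₂ d₂ φ₂ →
  IsDistinguishing (G₁ ⊕ G₂) (d₁ + d₂) (joinLabeling φ₁ φ₂)
joinLabeling-distinguishing {G₁} {G₂} {φ₁ = φ₁} {φ₂} dist₁ dist₂ σ aut pres = toSum-≗id σ s≗id
  where
  π : (Fin (n G₁) ⊎ Fin (n G₂)) ↔ (Fin (n G₁) ⊎ Fin (n G₂))
  π = toSum σ

  s : Fin (n G₁) ⊎ Fin (n G₂) → Fin (n G₁) ⊎ Fin (n G₂)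
  s = Inverse.to π

  pres⊎ : ∀ u → Sum.map φ₁ φ₂ (s u) ≡ Sum.map φ₁ φ₂ u
  pres⊎ = joinLabeling-preserved φ₁ φ₂ σ pres

  sp : SidePreserving s
  sp = map-preserved⇒sidePreserving φ₁ φ₂ s pres⊎

  aut⊎ : IsSumAutomorphism G₁ G₂ s
  aut⊎ = toSum-isSumAutomorphism G₁ G₂ σ aut

  s≗id : ∀ u → s u ≡ u
  s≗id u = begin
    s u                                            ≡⟨ sidePreserving-≗-map s sp u ⟩
    Sum.map (restrictˡ s) (restrictʳ s) u          ≡⟨ map-cong fix₁ fix₂ u ⟩
    Sum.map id id u                                ≡⟨ map-id u ⟩
    u                                              ∎
    where
    fix₁ : ∀ a → restrictˡ s a ≡ a
    fix₁ = dist₁ (restrictˡ-↔ π sp) (restrictˡ-isAutomorphism G₁ G₂ π sp aut⊎) (restrictˡ-preserves φ₁ φ₂ s pres⊎)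
    fix₂ : ∀ b → restrictʳ s b ≡ b
    fix₂ = dist₂ (restrictʳ-↔ π sp) (restrictʳ-isAutomorphism G₁ G₂ π sp aut⊎) (restrictʳ-preserves φ₁ φ₂ s pres⊎)

theorem2p1 : (G₁ G₂ : Graph) → Simple G₁ → Simple G₂ →
    Connected G₁ → Connected G₂ →
    (d₁ d₂ d : ℕ) →
    IsDistinguishingNumber G₁ d₁ → IsDistinguishingNumber G₂ d₂ →
    IsDistinguishingNumber (G₁ ⊕ G₂) d →
    (d₁ ⊔ d₂ ≤ d) × (d ≤ d₁ + d₂)
theorem2p1 G₁ G₂ _ _ _ _ d₁ d₂ d ((φ₁ , dist₁) , least₁) ((φ₂ , dist₂) , least₂) ((φ , dist) , least) =
  ⊔-lub (least₁ d (φ ∘ (_↑ˡ n G₂) , ↑ˡ-distinguishing dist))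
        (least₂ d (φ ∘ (n G₁ ↑ʳ_) , ↑ʳ-distinguishing dist)) ,
  least (d₁ + d₂) (joinLabeling φ₁ φ₂ , joinLabeling-distinguishing dist₁ dist₂)
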